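{- If $a[id]$ is well-formed, then $a[id]$ and $a$ have a common $\upsilon'$-reduct.
   Context: Named variables $x,y,z,\ldots$ ($\mathsf{x}$ ranges over them). Terms and substitutions: $a,b::=\mathsf{x}\mid\underline{1}\mid ab\mid\lambda a\mid a[s]$, $s::=b/\mid\,\uparrow\,\mid id\mid\,\Uparrow\! s$; $a[s][t]$ means $(a[s])[t]$. The system $\upsilon'$ consists of the following rules applicable to any subterm (including inside $b/$ and $\Uparrow\! s$): $(ab)[s]\to(a[s])(b[s])$; $(\lambda a)[s]\to\lambda(a[\Uparrow\! s])$; $\underline{1}[b/]\to b$; $a[\uparrow][b/]\to a$; $\underline{1}[id]\to\underline{1}$; $a[\uparrow][id]\to a[\uparrow]$; $\underline{1}[\Uparrow\! s]\to\underline{1}$; $a[\uparrow][\Uparrow\! s]\to a[s][\uparrow]$. A common $\upsilon'$-reduct of $a,b$ is a term reachable from both by zero or more $\upsilon'$-steps. Judgements $n\vdash a$ and $n\vdash s\triangleright m$ ($n,m\in\mathbb{N}$) are derived by: $0\vdash\mathsf{x}$; $n+1\vdash\underline{1}$; from $n\vdash a$, $n\vdash b$ infer $n\vdash ab$; from $n+1\vdash a$ infer $n\vdash\lambda a$; from $n\vdash s\triangleright m$, $m\vdash a$ infer $n\vdash a[s]$; from $n\vdash b$ infer $n\vdash b/\triangleright n+1$; $n+1\vdash\,\uparrow\triangleright n$; $n+1\vdash id\triangleright n+1$; from $n\vdash s\triangleright m$ infer $n+1\vdash\,\Uparrow\! s\triangleright m+1$. A term $a$ is well-formed iff $n\vdash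 a$ is derivable for some $n$. -}

module Defs where

open import Data.Nat using (ℕ; suc)
open import Data.Product using (∃; Σ-syntax; _×_)
open import Relation.Binary.Construct.Closure.ReflexiveTransitive using (Star)

Var : Set
Var = ℕ

mutual
  data Term : Set where
    var  : Var → Term
    one  : Term                 -- de Bruijn index 1 (underline 1)
    app  : Term → Term → Term
    lam  : Term → Term
    clos : Term → Subst → Term

  data Subst : Set where
    slash : Term → Subst
    shift : Subst
    idS   : Subst
    lift  : Subst → Subst

mutual
  data _⟶_ : Term → Term → Set where
    r-app    : ∀ {a b s} → clos (app a b) s ⟶ app (clos a s) (clos b s)
    r-lam    : ∀ {a s} → clos (lam a) s ⟶ lam (clos a (lift s))
    r-one-sl : ∀ {b} → clos one (slash b) ⟶ b
    r-sh-sl  : ∀ {a b} → clos (clos a shift) (slash b) ⟶ a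
    r-one-id : clos one idS ⟶ one
    r-sh-id  : ∀ {a} → clos (clos a shift) idS ⟶ clos a shift
    r-one-lf : ∀ {s} → clos one (lift s) ⟶ one
    r-sh-lf  : ∀ {a s} → clos (clos a shift) (lift s) ⟶ clos (clos a s) shift
    c-appˡ   : ∀ {a a′ b} → a ⟶ a′ → app a b ⟶ app a′ b
    c-appʳ   : ∀ {a b b′} → b ⟶ b′ → app a b ⟶ app a b′
    c-lam    : ∀ {a a′} → a ⟶ a′ → lam a ⟶ lam a′
    c-closˡ  : ∀ {a a′ s} → a ⟶ a′ → clos a s ⟶ clos a′ s
    c-closʳ  : ∀ {a s s′} → s ⟶ˢ s′ → clos a s ⟶ clos a s′

  data _⟶ˢ_ : Subst → Subst → Set where
    c-slash : ∀ {b b′} → b ⟶ b′ → slash b ⟶ˢ slash b′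
    c-lift  : ∀ {s s′} → s ⟶ˢ s′ → lift s ⟶ˢ lift s′

_⟶*_ : Term → Term → Set
_⟶*_ = Star _⟶_

CommonReduct : Term → Term → Set
CommonReduct a b = ∃ λ c → (a ⟶* c) × (b ⟶* c)

mutual
  data _⊢_ : ℕ → Term → Set where
    wf-var  : ∀ {x} → 0 ⊢ var x
    wf-one  : ∀ {n} → suc n ⊢ one
    wf-app  : ∀ {n a b} → n ⊢ a → n ⊢ b → n ⊢ app a b
    wf-lam  : ∀ {n a} → suc n ⊢ a → n ⊢ lam a
    wf-clos : ∀ {n m a s} → n ⊢ s ▷ m → m ⊢ a → n ⊢ clos a s

  data _⊢_▷_ : ℕ → Subst → ℕ → Set where
    wf-slash : ∀ {n b} → n ⊢ b → n ⊢ slash b ▷ suc n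
    wf-shift : ∀ {n} → suc n ⊢ shift ▷ n
    wf-id    : ∀ {n} → suc n ⊢ idS ▷ suc n
    wf-lift  : ∀ {n m s} → n ⊢ s ▷ m → suc n ⊢ lift s ▷ suc m

WellFormed : Term → Set
WellFormed a = ∃ λ n → n ⊢ a

module Submission where

-- Call a term *normal* (at depth n) if it is built from
-- variables, 1, application, abstraction and shifts a[↑] only; no υ′-rule
-- applies inside such a term.  Likewise a substitution is normal if every
-- term inside it is normal.
--
--   1. Applying a normal substitution to a normal term reduces to a normal
--      term (structural induction on the term; this is where the rules of
--      υ′ are used).
--   2. Hence every well-formed term (and substitution) reduces to a normal
--      one, by induction on the well-formedness derivation.
--   3. An "identity-like" substitution ⇑…⇑ id acts trivially on normal
--      terms: p[⇑ᵏ id] ⟶* p.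
--
-- For well-formed a[id], step 2 gives a ⟶* c with c normal, so
-- a[id] ⟶* c[id] ⟶* c by step 3, and c is the common reduct.

open import Defs
open import Data.Nat using (ℕ; suc)
open import Data.Product using (Σ-syntax; _×_; _,_)
open import Relation.Binary.Construct.Closure.ReflexiveTransitive
  using (Star; ε; _◅_; _◅◅_; gmap)

data Normal : ℕ → Term → Set where
  n-var   : ∀ {x} → Normal 0 (var x)
  n-one   : ∀ {n} → Normal (suc n) one
  n-app   : ∀ {n a b} → Normal n a → Normal n b → Normal n (app a b)
  n-lam   : ∀ {n a} → Normal (suc n) a → Normal n (lam a)
  n-shift : ∀ {n a} → Normal n a → Normal (suc n) (clos a shift)

data NormalS : ℕ → Subst → ℕ → Set where
  ns-slash : ∀ {n b} → Normal n b → NormalS n (slash b) (suc n)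
  ns-shift : ∀ {n} → NormalS (suc n) shift n
  ns-id    : ∀ {n} → NormalS (suc n) idS (suc n)
  ns-lift  : ∀ {n s m} → NormalS n s m → NormalS (suc n) (lift s) (suc m)

NormalisesAt : ℕ → Term → Set
NormalisesAt n a = Σ[ c ∈ Term ] (a ⟶* c × Normal n c)

_⟶ˢ*_ : Subst → Subst → Set
_⟶ˢ*_ = Star _⟶ˢ_

NormalisesS : ℕ → Subst → ℕ → Set
NormalisesS n s m = Σ[ t ∈ Subst ] (s ⟶ˢ* t × NormalS n t m)

app⟶* : ∀ {a a′ b b′} → a ⟶* a′ → b ⟶* b′ → app a b ⟶* app a′ b′
app⟶* a⟶*a′ b⟶*b′ = gmap (λ x → app x _) c-appˡ a⟶*a′ ◅◅ gmap (app _) c-appʳ b⟶*b′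

lam⟶* : ∀ {a a′} → a ⟶* a′ → lam a ⟶* lam a′
lam⟶* = gmap lam c-lam

closˡ⟶* : ∀ {a a′ s} → a ⟶* a′ → clos a s ⟶* clos a′ s
closˡ⟶* = gmap (λ x → clos x _) c-closˡ

closʳ⟶* : ∀ {a s s′} → s ⟶ˢ* s′ → clos a s ⟶* clos a s′
closʳ⟶* = gmap (clos _) c-closʳ

slash⟶* : ∀ {b b′} → b ⟶* b′ → slash b ⟶ˢ* slash b′
slash⟶* = gmap slash c-slash

lift⟶* : ∀ {s s′} → s ⟶ˢ* s′ → lift s ⟶ˢ* lift s′
lift⟶* = gmap lift c-lift

prepend : ∀ {n a b} → a ⟶* b → NormalisesAt n b → NormalisesAt n a
prepend a⟶*b (c , b⟶*c , nc) = c , a⟶*b ◅◅ b⟶*c , nc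

-- The substitution is pushed through app/λ, and the cases 1[s] and
-- a[↑][s] are resolved by the corresponding root rules (or are already
-- normal when s = ↑).
applyNormal : ∀ {n m a s} → Normal m a → NormalS n s m → NormalisesAt n (clos a s)
applyNormal n-var ns-shift = _ , ε , n-shift n-var
applyNormal n-one (ns-slash nb) = _ , r-one-sl ◅ ε , nb
applyNormal n-one ns-shift = _ , ε , n-shift n-one
applyNormal n-one ns-id = _ , r-one-id ◅ ε , n-one
applyNormal n-one (ns-lift _) = _ , r-one-lf ◅ ε , n-one
applyNormal (n-app na nb) ns with applyNormal na ns | applyNormal nb ns
... | c , as⟶*c , nc | d , bs⟶*d , nd = _ , r-app ◅ app⟶* as⟶*c bs⟶*d , n-app nc nd
applyNormal (n-lam na) ns with applyNormal na (ns-lift ns)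
... | c , a⇑s⟶*c , nc = _ , r-lam ◅ lam⟶* a⇑s⟶*c , n-lam nc
applyNormal (n-shift na) (ns-slash _) = _ , r-sh-sl ◅ ε , na
applyNormal (n-shift na) ns-shift = _ , ε , n-shift (n-shift na)
applyNormal (n-shift na) ns-id = _ , r-sh-id ◅ ε , n-shift na
applyNormal (n-shift na) (ns-lift nt) with applyNormal na nt
... | c , at⟶*c , nc = _ , r-sh-lf ◅ closˡ⟶* at⟶*c , n-shift nc

mutual
  normalise : ∀ {n a} → n ⊢ a → NormalisesAt n a
  normalise wf-var = _ , ε , n-var
  normalise wf-one = _ , ε , n-one
  normalise (wf-app wa wb) with normalise wa | normalise wb
  ... | c , a⟶*c , nc | d , b⟶*d , nd = _ , app⟶* a⟶*c b⟶*d , n-app nc nd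
  normalise (wf-lam wa) with normalise wa
  ... | c , a⟶*c , nc = _ , lam⟶* a⟶*c , n-lam nc
  normalise (wf-clos ws wa) with normalise wa | normaliseS ws
  ... | c , a⟶*c , nc | t , s⟶*t , nt =
    prepend (closˡ⟶* a⟶*c ◅◅ closʳ⟶* s⟶*t) (applyNormal nc nt)

  normaliseS : ∀ {n s m} → n ⊢ s ▷ m → NormalisesS n s m
  normaliseS (wf-slash wb) with normalise wb
  ... | c , b⟶*c , nc = _ , slash⟶* b⟶*c , ns-slash nc
  normaliseS wf-shift = _ , ε , ns-shift
  normaliseS wf-id = _ , ε , ns-id
  normaliseS (wf-lift ws) with normaliseS ws
  ... | t , s⟶*t , nt = _ , lift⟶* s⟶*t , ns-lift nt

-- The substitutions ⇑ᵏ id, indexed by the depth at which they are typed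
-- (n ⊢ ⇑ᵏ id ▷ n with n > k).
data IdLike : ℕ → Subst → Set where
  il-id   : ∀ {n} → IdLike (suc n) idS
  il-lift : ∀ {n s} → IdLike n s → IdLike (suc n) (lift s)

-- Step 3: identity-like substitutions vanish on normal terms.  The depth
-- index rules out a bare variable (depth 0) meeting ⇑ᵏ id (depth ≥ 1),
-- where no rule would apply.
idLikeVanishes : ∀ {n p s} → Normal n p → IdLike n s → clos p s ⟶* p
idLikeVanishes n-one il-id = r-one-id ◅ ε
idLikeVanishes n-one (il-lift _) = r-one-lf ◅ ε
idLikeVanishes (n-app na nb) is = r-app ◅ app⟶* (idLikeVanishes na is) (idLikeVanishes nb is)
idLikeVanishes (n-lam na) is = r-lam ◅ lam⟶* (idLikeVanishes na (il-lift is))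
idLikeVanishes (n-shift na) il-id = r-sh-id ◅ ε
idLikeVanishes (n-shift na) (il-lift is) = r-sh-lf ◅ closˡ⟶* (idLikeVanishes na is)

mainTheorem18 : ∀ (a : Term) → WellFormed (clos a idS) → CommonReduct (clos a idS) a
mainTheorem18 a (_ , wf-clos wf-id wa) with normalise wa
... | c , a⟶*c , nc = c , closˡ⟶* a⟶*c ◅◅ idLikeVanishes nc il-id , a⟶*c
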